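{- Let $G$ be a chordal graph and let $v$ be an internal vertex of $G$. Then $G_v$ is a chordal graph and $c(G_v)<c(G)$, where $c(\cdot)$ denotes the number of maximal cliques.
   Context: A vertex is free if it belongs to exactly one maximal clique of the graph, and internal otherwise. $G_v$ is the graph on $V(G)$ with edge set $E(G)\cup\{\{u,w\}: u,w\in N_G(v), u\ne w\}$, where $N_G(v)$ is the set of neighbours of $v$. -}

module Defs where

open import Level using (0ℓ)
open import Data.Nat using (ℕ; zero; suc; _+_; _<_)
open import Data.Nat.DivMod using (_%_; m%n<n)
open import Data.Fin using (Fin; toℕ; fromℕ<)
open import Data.Fin.Subset using (Subset; _∈_; _⊆_)
open import Data.List using (List; length)
import Data.List.Membership.Propositional as LM
open import Data.List.Relation.Unary.Unique.Propositional using (Unique)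
open import Data.Product using (Σ; ∃; ∃-syntax; _×_; _,_)
open import Data.Sum using (_⊎_; inj₁; inj₂)
open import Data.Empty using (⊥)
open import Relation.Nullary using (¬_)
open import Relation.Binary.PropositionalEquality using (_≡_; _≢_; refl; sym)
open import Function using (_⇔_)
open import Function.Definitions using (Injective)

record Graph (n : ℕ) : Set₁ where
  field
    Adj    : Fin n → Fin n → Set
    adj-sym : ∀ {u w} → Adj u w → Adj w u
    irrefl : ∀ {u} → ¬ Adj u u
open Graph public

module _ {n : ℕ} (G : Graph n) where

  IsClique : Subset n → Set
  IsClique C = ∀ u w → u ∈ C → w ∈ C → u ≢ w → Adj G u w

  IsMaximalClique : Subset n → Set
  IsMaximalClique C = IsClique C × (∀ D → IsClique D → C ⊆ D → D ⊆ C)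

  IsFree : Fin n → Set
  IsFree v = ∃[ C ] (IsMaximalClique C × v ∈ C ×
                     (∀ D → IsMaximalClique D → v ∈ D → D ≡ C))

  IsInternal : Fin n → Set
  IsInternal v = ¬ IsFree v

next : ∀ {k} → Fin (suc k) → Fin (suc k)
next {k} i = fromℕ< (m%n<n (suc (toℕ i)) (suc k))

-- A cycle of length m+4 is an injective map c : Fin (m+4) → Fin n with
-- c i adjacent to c (i+1 mod (m+4)); a chord is an edge between two
-- cycle vertices that are not consecutive on the cycle.
IsChordal : ∀ {n} → Graph n → Set
IsChordal {n} G =
  ∀ (m : ℕ) (c : Fin (suc (suc (suc (suc m)))) → Fin n) →
  Injective _≡_ _≡_ c →
  (∀ i → Adj G (c i) (c (next i))) →
  ∃[ i ] ∃[ j ] (i ≢ j × j ≢ next i × i ≢ next j × Adj G (c i) (c j))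

_⟨_⟩ : ∀ {n} → Graph n → Fin n → Graph n
G ⟨ v ⟩ = record
  { Adj    = λ u w → Adj G u w ⊎ (u ≢ w × Adj G v u × Adj G v w)
  ; adj-sym = λ { (inj₁ a) → inj₁ (adj-sym G a)
               ; (inj₂ (ne , a , b)) → inj₂ ((λ e → ne (sym e)) , b , a) }
  ; irrefl = λ { (inj₁ a) → irrefl G a ; (inj₂ (ne , _)) → ne refl }
  }

HasCount : ∀ {n} → (Subset n → Set) → ℕ → Set
HasCount {n} P k =
  Σ (List (Subset n)) λ L → Unique L × (∀ C → (C LM.∈ L) ⇔ P C) × length L ≡ k

NumMaxCliques : ∀ {n} → Graph n → ℕ → Set
NumMaxCliques G k = HasCount (IsMaximalClique G) k

module Submission where

-- A cycle of G ⟨ v ⟩ of length at least four that uses a new edge is rotated so that a new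
-- edge x y closes it. A neighbour of v strictly inside the path from y to x is adjacent in
-- G ⟨ v ⟩ to both x and y, which yields a chord. Otherwise all edges of the path lie in G and v
-- is not on it (v itself would give the chord), so together with v it forms a longer cycle of G;
-- a chord of that cycle is either a chord of the original one, the edge x y (then the whole
-- cycle lies in G), or joins v to an inner vertex, which is then a neighbour of v.
--
-- For the count: a maximal clique of G ⟨ v ⟩ avoiding v is still a clique of G, since a new edge
-- u w inside it, together with v and a vertex of the clique not adjacent to v (which exists by
-- maximality), would form a 4-cycle of G whose only possible diagonal is u w. All maximal cliques
-- of G ⟨ v ⟩ through v coincide. Mapping that clique to one maximal clique K of G through v and
-- keeping the others is therefore injective, and it misses a second maximal clique of G through
-- v, which exists because v is internal. Adjacency need not be decidable, but the inequality is,
-- so it may be proved assuming decidable adjacency.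

open import Defs
open import Data.Bool using (if_then_else_)
open import Data.Bool.Properties using () renaming (_≟_ to _≟ᵇ_)
open import Data.Empty using (⊥-elim)
open import Data.Fin using (Fin; zero; suc; toℕ; fromℕ; inject₁)
open import Data.Fin.Induction using (<-weakInduction)
open import Data.Fin.Patterns using (0F; 1F; 2F; 3F)
open import Data.Fin.Properties
  using (any?; all?; toℕ-injective; toℕ-fromℕ<; toℕ-fromℕ; toℕ-inject₁; inject₁ℕ<; suc-injective; fromℕ≢inject₁)
  renaming (_≟_ to _≟ᶠ_)
open import Data.Fin.Relation.Unary.Top using (view; ‵fromℕ; ‵inject₁)
open import Data.Fin.Subset using (Subset; _∈_; _∉_; _⊆_; _∪_; ⁅_⁆; ∣_∣)
open import Data.Fin.Subset.Properties
  using (_∈?_; ⊆-antisym; p⊂q⇒∣p∣<∣q∣; ∣p∣≤n; x∈⁅x⁆; x∈⁅y⁆⇒x≡y; x∈p∪q⁻; p⊆p∪q; q⊆p∪q)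
open import Data.List using (List; []; _∷_; length; map)
open import Data.List.Membership.Propositional using (_─_; find; lose) renaming (_∈_ to _∈ᴸ_)
open import Data.List.Membership.Propositional.Properties using (∈-map⁻)
open import Data.List.Properties using (length-map; length-removeAt′)
open import Data.List.Relation.Binary.Subset.Propositional using () renaming (_⊆_ to _⊆ᴸ_)
import Data.List.Relation.Unary.All as All
open import Data.List.Relation.Unary.All.Properties using () renaming (map⁺ to All-map⁺)
open import Data.List.Relation.Unary.Any using (here; there; index) renaming (any? to anyᴸ?)
open import Data.List.Relation.Unary.AllPairs using ([]; _∷_)
open import Data.List.Relation.Unary.Unique.Propositional using (Unique)
open import Data.Nat using (ℕ; zero; suc; _+_; _<_; _≤_; _<?_; z≤n; s≤s)
open import Data.Nat.DivMod using (_%_; m<n⇒m%n≡m; n%n≡0)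
open import Data.Nat.Properties using (≤-trans; +-suc; +-monoʳ-≤; m≤m+n; <⇒≱; module ≤-Reasoning)
open import Data.Product using (∃-syntax; _×_; _,_; proj₁; proj₂)
open import Data.Sum using (_⊎_; inj₁; inj₂; [_,_]′)
open import Data.Vec.Functional using () renaming ([] to []ᵛ; _∷_ to _∷ᵛ_)
open import Data.Vec.Properties using (≡-dec)
open import Function using (_∘_; id)
open import Function.Bundles using (Equivalence)
open import Function.Definitions using (Injective)
open import Relation.Nullary using (¬_; Dec; yes; no; does; contradiction; ¬¬-map)
open import Relation.Nullary.Decidable using (decidable-stable; ¬?; _×-dec_; _→-dec_; ¬¬-excluded-middle)
open import Relation.Binary.PropositionalEquality
  using (_≡_; _≢_; refl; sym; trans; cong; subst; module ≡-Reasoning)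

next-inject₁ : ∀ {k} (j : Fin k) → next (inject₁ j) ≡ suc j
next-inject₁ {k} j = toℕ-injective (begin
  toℕ (next (inject₁ j))        ≡⟨ toℕ-fromℕ< _ ⟩
  suc (toℕ (inject₁ j)) % suc k ≡⟨ m<n⇒m%n≡m (s≤s (inject₁ℕ< j)) ⟩
  suc (toℕ (inject₁ j))         ≡⟨ cong suc (toℕ-inject₁ j) ⟩
  suc (toℕ j)                   ∎)
  where open ≡-Reasoning

next-fromℕ : ∀ k → next (fromℕ k) ≡ zero
next-fromℕ k = toℕ-injective (begin
  toℕ (next (fromℕ k))        ≡⟨ toℕ-fromℕ< _ ⟩
  suc (toℕ (fromℕ k)) % suc k ≡⟨ cong (λ t → suc t % suc k) (toℕ-fromℕ k) ⟩
  suc k % suc k               ≡⟨ n%n≡0 (suc k) ⟩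
  0                           ∎)
  where open ≡-Reasoning

next-injective : ∀ {k} → Injective _≡_ _≡_ (next {k})
next-injective {k} {i} {j} eq with view i | view j
... | ‵fromℕ      | ‵fromℕ      = refl
... | ‵fromℕ      | ‵inject₁ j′ = contradiction (trans (sym (next-fromℕ k)) (trans eq (next-inject₁ j′))) λ ()
... | ‵inject₁ i′ | ‵fromℕ      = contradiction (trans (sym (next-fromℕ k)) (trans (sym eq) (next-inject₁ i′))) λ ()
... | ‵inject₁ i′ | ‵inject₁ j′ =
  cong inject₁ (suc-injective (trans (sym (next-inject₁ i′)) (trans eq (next-inject₁ j′))))

next-suc : ∀ {k} (i : Fin (suc k)) → i ≢ fromℕ k → next (suc i) ≡ suc (next i)
next-suc i i≢ℓ with view i
... | ‵fromℕ     = contradiction refl i≢ℓ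
... | ‵inject₁ j = trans (next-inject₁ (suc j)) (cong suc (sym (next-inject₁ j)))

byRotationToLast : ∀ {A : Set} {k} (R : A → A → Set) (Q : (Fin (suc k) → A) → Set) →
  (∀ c → Q (c ∘ next) → Q c) → (∀ c → R (c (fromℕ k)) (c zero) → Q c) →
  ∀ c i → R (c i) (c (next i)) → Q c
byRotationToLast {k = k} R Q Q-rotate Q-last c i = <-weakInduction EdgeSuffices edge-zero edge-suc i c
  where
  EdgeSuffices : Fin (suc k) → Set
  EdgeSuffices i = ∀ c → R (c i) (c (next i)) → Q c
  edge-next : ∀ i → EdgeSuffices i → EdgeSuffices (next i)
  edge-next i suffices c r = Q-rotate c (suffices (c ∘ next) r)
  edge-last : EdgeSuffices (fromℕ k)
  edge-last c = Q-last c ∘ subst (R (c (fromℕ k)) ∘ c) (next-fromℕ k)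
  edge-zero : EdgeSuffices zero
  edge-zero = subst EdgeSuffices (next-fromℕ k) (edge-next _ edge-last)
  edge-suc : ∀ i → EdgeSuffices (inject₁ i) → EdgeSuffices (suc i)
  edge-suc i = subst EdgeSuffices (next-inject₁ i) ∘ edge-next _

∷-injective : ∀ {A : Set} {k} {x : A} {f : Fin k → A} →
  (∀ i → x ≢ f i) → Injective _≡_ _≡_ f → Injective _≡_ _≡_ (x ∷ᵛ f)
∷-injective x∉f f-inj {zero}  {zero}  _  = refl
∷-injective x∉f f-inj {zero}  {suc j} eq = contradiction eq (x∉f j)
∷-injective x∉f f-inj {suc i} {zero}  eq = contradiction (sym eq) (x∉f i)
∷-injective x∉f f-inj {suc i} {suc j} eq = cong suc (f-inj eq)

[]-injective : ∀ {A : Set} → Injective _≡_ _≡_ ([]ᵛ {A = A})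
[]-injective {x = ()}

all⊎any : ∀ {k} {P Q : Fin k → Set} → (∀ i → P i ⊎ Q i) → (∀ i → P i) ⊎ ∃[ i ] Q i
all⊎any {zero} _ = inj₁ λ ()
all⊎any {suc k} p⊎q with p⊎q zero | all⊎any (p⊎q ∘ suc)
... | inj₂ q | _            = inj₂ (zero , q)
... | inj₁ p | inj₁ ps      = inj₁ λ { zero → p ; (suc i) → ps i }
... | inj₁ _ | inj₂ (i , q) = inj₂ (suc i , q)

Adj⇒≢ : ∀ {n} (G : Graph n) {u w} → Adj G u w → u ≢ w
Adj⇒≢ G u~w refl = irrefl G u~w

Chord : ∀ {n k} → Graph n → (Fin (suc k) → Fin n) → Set
Chord H c = ∃[ i ] ∃[ j ] (i ≢ j × j ≢ next i × i ≢ next j × Adj H (c i) (c j))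

Chord-mono : ∀ {n k} {G H : Graph n} {c : Fin (suc k) → Fin n} →
  (∀ {u w} → Adj G u w → Adj H u w) → Chord G c → Chord H c
Chord-mono G⊆H (i , j , i≢j , j≢i⁺ , i≢j⁺ , a) = i , j , i≢j , j≢i⁺ , i≢j⁺ , G⊆H a

Chord-rotate : ∀ {n k} {H : Graph n} {c : Fin (suc k) → Fin n} → Chord H (c ∘ next) → Chord H c
Chord-rotate (i , j , i≢j , j≢i⁺ , i≢j⁺ , a) =
  next i , next j , i≢j ∘ next-injective , j≢i⁺ ∘ next-injective , i≢j⁺ ∘ next-injective , a

chord-adjacentToClosingEdge : ∀ {n m} {H : Graph n} (c : Fin (suc (suc (suc (suc m)))) → Fin n) j →
  j ≢ zero → j ≢ fromℕ _ → Adj H (c j) (c (fromℕ _)) → Adj H (c j) (c zero) → Chord H c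
chord-adjacentToClosingEdge c zero j≢0 _ _ _ = contradiction refl j≢0
chord-adjacentToClosingEdge c 1F _ _ jℓ _ =
  1F , fromℕ _ , (λ ()) , (λ ()) , (λ e → contradiction (trans e (next-fromℕ _)) λ ()) , jℓ
chord-adjacentToClosingEdge c j@(suc (suc _)) _ j≢ℓ _ j0 =
  j , zero , (λ ()) , (λ e → j≢ℓ (next-injective (trans (sym e) (sym (next-fromℕ _))))) , (λ ()) , j0

square-chord : ∀ {n} {H : Graph n} {c : Fin 4 → Fin n} → Chord H c → Adj H (c 0F) (c 2F) ⊎ Adj H (c 1F) (c 3F)
square-chord (0F , 0F , p , _ , _ , _) = contradiction refl p
square-chord (0F , 1F , _ , p , _ , _) = contradiction refl p
square-chord (0F , 2F , _ , _ , _ , a) = inj₁ a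
square-chord (0F , 3F , _ , _ , p , _) = contradiction refl p
square-chord (1F , 0F , _ , _ , p , _) = contradiction refl p
square-chord (1F , 1F , p , _ , _ , _) = contradiction refl p
square-chord (1F , 2F , _ , p , _ , _) = contradiction refl p
square-chord (1F , 3F , _ , _ , _ , a) = inj₂ a
square-chord {H = H} (2F , 0F , _ , _ , _ , a) = inj₁ (adj-sym H a)
square-chord (2F , 1F , _ , _ , p , _) = contradiction refl p
square-chord (2F , 2F , p , _ , _ , _) = contradiction refl p
square-chord (2F , 3F , _ , p , _ , _) = contradiction refl p
square-chord (3F , 0F , _ , p , _ , _) = contradiction refl p
square-chord {H = H} (3F , 1F , _ , _ , _ , a) = inj₂ (adj-sym H a)
square-chord (3F , 2F , _ , _ , p , _) = contradiction refl p
square-chord (3F , 3F , p , _ , _ , _) = contradiction refl p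

chordal-square-diagonal : ∀ {n} {G : Graph n} → IsChordal G → ∀ {a b c d} →
  Adj G a b → Adj G b c → Adj G c d → Adj G d a → a ≢ c → b ≢ d → Adj G a c ⊎ Adj G b d
chordal-square-diagonal {G = G} chordal {a} {b} {c} {d} a~b b~c c~d d~a a≢c b≢d =
  square-chord {H = G} (chordal 0 (a ∷ᵛ b ∷ᵛ c ∷ᵛ d ∷ᵛ []ᵛ) square-injective edge)
  where
  square-injective : Injective _≡_ _≡_ (a ∷ᵛ b ∷ᵛ c ∷ᵛ d ∷ᵛ []ᵛ)
  square-injective =
    ∷-injective (λ { 0F → Adj⇒≢ G a~b ; 1F → a≢c ; 2F → Adj⇒≢ G d~a ∘ sym })
    (∷-injective (λ { 0F → Adj⇒≢ G b~c ; 1F → b≢d })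
    (∷-injective (λ { 0F → Adj⇒≢ G c~d }) (∷-injective (λ ()) []-injective)))
  edge : ∀ i → Adj G ((a ∷ᵛ b ∷ᵛ c ∷ᵛ d ∷ᵛ []ᵛ) i) ((a ∷ᵛ b ∷ᵛ c ∷ᵛ d ∷ᵛ []ᵛ) (next i))
  edge 0F = a~b
  edge 1F = b~c
  edge 2F = c~d
  edge 3F = d~a

module _ {n} {G : Graph n} {v : Fin n} (chordal : IsChordal G) where

  module _ {m} (c : Fin (suc (suc (suc (suc m)))) → Fin n) (c-inj : Injective _≡_ _≡_ c)
           (cycle : ∀ i → Adj (G ⟨ v ⟩) (c i) (c (next i)))
           (v~ℓ : Adj G v (c (fromℕ _))) (v~0 : Adj G v (c zero)) where

    neighbour-chord : ∀ j → j ≢ zero → j ≢ fromℕ _ → Adj G v (c j) → Chord (G ⟨ v ⟩) c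
    neighbour-chord j j≢0 j≢ℓ v~j = chord-adjacentToClosingEdge {H = G ⟨ v ⟩} c j j≢0 j≢ℓ
      (inj₂ (j≢ℓ ∘ c-inj , v~j , v~ℓ)) (inj₂ (j≢0 ∘ c-inj , v~j , v~0))

    InnerEdgesInG : Set
    InnerEdgesInG = ∀ j → Adj G (c (inject₁ j)) (c (next (inject₁ j)))

    closingEdgeInG-chord : InnerEdgesInG → Adj G (c (fromℕ _)) (c zero) → Chord (G ⟨ v ⟩) c
    closingEdgeInG-chord inner ℓ~0 = Chord-mono {G = G} {H = G ⟨ v ⟩} inj₁ (chordal m c c-inj edge)
      where
      edge : ∀ i → Adj G (c i) (c (next i))
      edge i with view i
      ... | ‵fromℕ     = subst (Adj G (c (fromℕ _)) ∘ c) (sym (next-fromℕ _)) ℓ~0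
      ... | ‵inject₁ j = inner j

    consecutive⇒closingEdge : ∀ x → suc (next x) ≢ next (suc x) → Adj G (c x) (c (next x)) →
      Adj G (c (fromℕ _)) (c zero)
    consecutive⇒closingEdge x x⁺≢ a with x ≟ᶠ fromℕ _
    ... | no x≢ℓ   = contradiction (sym (next-suc x x≢ℓ)) x⁺≢
    ... | yes refl = subst (Adj G (c (fromℕ _)) ∘ c) (next-fromℕ _) a

    apexChord⇒chord : InnerEdgesInG → Chord G (v ∷ᵛ c) → Chord (G ⟨ v ⟩) c
    apexChord⇒chord _ (zero , zero , p , _) = contradiction refl p
    apexChord⇒chord _ (zero , suc j , _ , j≢1 , 0≢j⁺ , a) =
      neighbour-chord j (λ { refl → j≢1 refl }) (λ { refl → 0≢j⁺ (sym (next-fromℕ _)) }) a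
    apexChord⇒chord _ (suc j , zero , _ , 0≢j⁺ , j≢1 , a) =
      neighbour-chord j (λ { refl → j≢1 refl }) (λ { refl → 0≢j⁺ (sym (next-fromℕ _)) }) (adj-sym G a)
    apexChord⇒chord inner (suc x , suc y , x≢y , y≢x⁺ , x≢y⁺ , a) with y ≟ᶠ next x | x ≟ᶠ next y
    ... | yes refl | _        = closingEdgeInG-chord inner (consecutive⇒closingEdge x y≢x⁺ a)
    ... | no _     | yes refl = closingEdgeInG-chord inner (consecutive⇒closingEdge y x≢y⁺ (adj-sym G a))
    ... | no y≢x⁺′ | no x≢y⁺′ = x , y , x≢y ∘ cong suc , y≢x⁺′ , x≢y⁺′ , inj₁ a

    apexCycle-chord : (∀ i → v ≢ c i) → InnerEdgesInG → Chord (G ⟨ v ⟩) c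
    apexCycle-chord v∉c inner = apexChord⇒chord inner (chordal (suc m) (v ∷ᵛ c) (∷-injective v∉c c-inj) edge)
      where
      edge : ∀ p → Adj G ((v ∷ᵛ c) p) ((v ∷ᵛ c) (next p))
      edge zero = v~0
      edge (suc i) with view i
      ... | ‵fromℕ     = subst (Adj G (c (fromℕ _)) ∘ (v ∷ᵛ c)) (sym (next-fromℕ _)) (adj-sym G v~ℓ)
      ... | ‵inject₁ j = subst (Adj G (c (inject₁ j)) ∘ (v ∷ᵛ c))
                               (sym (next-suc (inject₁ j) (fromℕ≢inject₁ ∘ sym))) (inner j)

    closingEdgeNew-chord : Chord (G ⟨ v ⟩) c
    closingEdgeNew-chord with all⊎any (cycle ∘ inject₁)
    ... | inj₂ (zero  , _ , _ , v~1) = neighbour-chord 1F (λ ()) (λ ()) v~1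
    ... | inj₂ (suc j , _ , v~j , _) = neighbour-chord (inject₁ (suc j)) (λ ()) (fromℕ≢inject₁ ∘ sym) v~j
    ... | inj₁ inner with any? (λ i → v ≟ᶠ c i)
    ...   | no v∉c         = apexCycle-chord (λ i → v∉c ∘ (i ,_)) inner
    ...   | yes (i , refl) = chord-adjacentToClosingEdge {H = G ⟨ v ⟩} c i
            (λ { refl → irrefl G v~0 }) (λ { refl → irrefl G v~ℓ }) (inj₁ v~ℓ) (inj₁ v~0)

  ⟨⟩-chordal : IsChordal (G ⟨ v ⟩)
  ⟨⟩-chordal m c c-inj cycle with all⊎any cycle
  ... | inj₁ old = Chord-mono {G = G} {H = G ⟨ v ⟩} inj₁ (chordal m c c-inj old)
  ... | inj₂ (i , _ , v~i , v~i⁺) =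
    byRotationToLast (λ x y → Adj G v x × Adj G v y) CycleHasChord rotate closing c i (v~i , v~i⁺) c-inj cycle
    where
    CycleHasChord : (Fin (suc (suc (suc (suc m)))) → Fin n) → Set
    CycleHasChord d = Injective _≡_ _≡_ d → (∀ i → Adj (G ⟨ v ⟩) (d i) (d (next i))) → Chord (G ⟨ v ⟩) d
    rotate : ∀ d → CycleHasChord (d ∘ next) → CycleHasChord d
    rotate d has d-inj d-cycle = Chord-rotate {H = G ⟨ v ⟩} (has (next-injective ∘ d-inj) (d-cycle ∘ next))
    closing : ∀ d → Adj G v (d (fromℕ _)) × Adj G v (d zero) → CycleHasChord d
    closing d (v~ℓ , v~0) d-inj d-cycle = closingEdgeNew-chord d d-inj d-cycle v~ℓ v~0

∈-─ : ∀ {A : Set} {x y : A} {ys} (x∈ys : x ∈ᴸ ys) → y ∈ᴸ ys → y ≢ x → y ∈ᴸ ys ─ x∈ys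
∈-─ (here refl) (here refl) y≢x = contradiction refl y≢x
∈-─ (here _)    (there y∈)  _   = y∈
∈-─ (there _)   (here y≡)   _   = here y≡
∈-─ (there x∈)  (there y∈)  y≢x = there (∈-─ x∈ y∈ y≢x)

Unique-⊆⇒length-≤ : ∀ {A : Set} {xs ys : List A} → Unique xs → xs ⊆ᴸ ys → length xs ≤ length ys
Unique-⊆⇒length-≤ {xs = []} _ _ = z≤n
Unique-⊆⇒length-≤ {xs = x ∷ xs} {ys} (x∉xs ∷ xs!) xs⊆ys = begin
  suc (length xs)          ≤⟨ s≤s (Unique-⊆⇒length-≤ xs! xs⊆ys─x) ⟩
  suc (length (ys ─ x∈ys)) ≡⟨ length-removeAt′ ys (index x∈ys) ⟨
  length ys                ∎
  where
  open ≤-Reasoning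
  x∈ys : x ∈ᴸ ys
  x∈ys = xs⊆ys (here refl)
  xs⊆ys─x : xs ⊆ᴸ ys ─ x∈ys
  xs⊆ys─x y∈xs = ∈-─ x∈ys (xs⊆ys (there y∈xs)) (All.lookup x∉xs y∈xs ∘ sym)

Unique-map⁺ : ∀ {A B : Set} {xs : List A} (f : A → B) →
  (∀ {x y} → x ∈ᴸ xs → y ∈ᴸ xs → f x ≡ f y → x ≡ y) → Unique xs → Unique (map f xs)
Unique-map⁺ f _ [] = []
Unique-map⁺ f f-inj (x∉xs ∷ xs!) =
  All-map⁺ (All.tabulate λ y∈xs → All.lookup x∉xs y∈xs ∘ f-inj (here refl) (there y∈xs))
  ∷ Unique-map⁺ f (λ x∈ y∈ → f-inj (there x∈) (there y∈)) xs!

HasCount-<-injection : ∀ {n} {P Q : Subset n → Set} {a b} → HasCount P a → HasCount Q b →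
  (f : Subset n → Subset n) → (∀ {C} → P C → Q (f C)) → (∀ {C D} → P C → P D → f C ≡ f D → C ≡ D) →
  ∀ D → Q D → (∀ {C} → P C → f C ≢ D) → a < b
HasCount-<-injection {P = P} (La , La! , ∈La , refl) (Lb , _ , ∈Lb , refl) f f-maps f-inj D QD missed =
  subst (_≤ length Lb) (cong suc (length-map f La)) (Unique-⊆⇒length-≤ (D∉image ∷ image!) D∷image⊆Lb)
  where
  P-of : ∀ {C} → C ∈ᴸ La → P C
  P-of {C} = Equivalence.to (∈La C)
  image! : Unique (map f La)
  image! = Unique-map⁺ f (λ C∈ D∈ → f-inj (P-of C∈) (P-of D∈)) La!
  D∉image : All.All (D ≢_) (map f La)
  D∉image = All-map⁺ (All.tabulate λ C∈ → missed (P-of C∈) ∘ sym)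
  D∷image⊆Lb : (D ∷ map f La) ⊆ᴸ Lb
  D∷image⊆Lb (here refl) = Equivalence.from (∈Lb D) QD
  D∷image⊆Lb (there fC∈) with ∈-map⁻ f fC∈
  ... | C , C∈ , refl = Equivalence.from (∈Lb _) (f-maps (P-of C∈))

x∉p⇒∣p∣<∣p∪⁅x⁆∣ : ∀ {n} {p : Subset n} {x} → x ∉ p → ∣ p ∣ < ∣ p ∪ ⁅ x ⁆ ∣
x∉p⇒∣p∣<∣p∪⁅x⁆∣ {p = p} {x} x∉p = p⊂q⇒∣p∣<∣q∣ (p⊆p∪q ⁅ x ⁆ , x , q⊆p∪q p ⁅ x ⁆ (x∈⁅x⁆ x) , x∉p)

⁅⁆-clique : ∀ {n} (G : Graph n) x → IsClique G ⁅ x ⁆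
⁅⁆-clique G x a b a∈ b∈ a≢b = contradiction (trans (x∈⁅y⁆⇒x≡y x a∈) (sym (x∈⁅y⁆⇒x≡y x b∈))) a≢b

module _ {n} {G : Graph n} (Adj? : ∀ u w → Dec (Adj G u w)) where

  Extends : Subset n → Fin n → Set
  Extends C x = x ∉ C × (∀ y → y ∈ C → Adj G x y)

  extends? : ∀ C x → Dec (Extends C x)
  extends? C x = ¬? (x ∈? C) ×-dec all? (λ y → y ∈? C →-dec Adj? x y)

  ∪⁅⁆-clique : ∀ {C x} → IsClique G C → Extends C x → IsClique G (C ∪ ⁅ x ⁆)
  ∪⁅⁆-clique {C} {x} C-clique (_ , x~C) a b a∈ b∈ a≢b with x∈p∪q⁻ C ⁅ x ⁆ a∈ | x∈p∪q⁻ C ⁅ x ⁆ b∈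
  ... | inj₁ a∈C | inj₁ b∈C = C-clique a b a∈C b∈C a≢b
  ... | inj₁ a∈C | inj₂ b∈x rewrite x∈⁅y⁆⇒x≡y x b∈x = adj-sym G (x~C a a∈C)
  ... | inj₂ a∈x | inj₁ b∈C rewrite x∈⁅y⁆⇒x≡y x a∈x = x~C b b∈C
  ... | inj₂ a∈x | inj₂ b∈x = ⁅⁆-clique G x a b a∈x b∈x a≢b

  unextendable⇒maximal : ∀ {C} → IsClique G C → (∀ x → ¬ Extends C x) → IsMaximalClique G C
  unextendable⇒maximal {C} C-clique stuck = C-clique , λ D D-clique C⊆D {y} y∈D →
    decidable-stable (y ∈? C) λ y∉C →
      stuck y (y∉C , λ z z∈C → D-clique y z y∈D (C⊆D z∈C) λ { refl → y∉C z∈C })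

  maximalClique-⊇ : ∀ {C} → IsClique G C → ∃[ D ] (IsMaximalClique G D × C ⊆ D)
  maximalClique-⊇ {C} = grow n (m≤m+n n ∣ C ∣)
    where
    grow : ∀ k {C} → n ≤ k + ∣ C ∣ → IsClique G C → ∃[ D ] (IsMaximalClique G D × C ⊆ D)
    grow k {C} bound C-clique with any? (extends? C) | k
    ... | no stuck | _ = C , unextendable⇒maximal C-clique (λ x ext → stuck (x , ext)) , id
    ... | yes (x , x∉C , _) | zero =
      contradiction (∣p∣≤n (C ∪ ⁅ x ⁆)) (<⇒≱ (≤-trans (s≤s bound) (x∉p⇒∣p∣<∣p∪⁅x⁆∣ x∉C)))
    ... | yes (x , ext) | suc k′
      with D , D-maximal , C⁺⊆D ← grow k′ (≤-trans bound (subst (_≤ k′ + ∣ C ∪ ⁅ x ⁆ ∣) (+-suc k′ ∣ C ∣)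
                                             (+-monoʳ-≤ k′ (x∉p⇒∣p∣<∣p∪⁅x⁆∣ (proj₁ ext)))))
                                         (∪⁅⁆-clique C-clique ext)
      = D , D-maximal , C⁺⊆D ∘ p⊆p∪q ⁅ x ⁆

module _ {n} {G : Graph n} {v : Fin n} where

  ClosedNeighbour : Fin n → Set
  ClosedNeighbour x = x ≡ v ⊎ Adj G v x

  closedNeighbours-adjacent : ∀ {a b} → ClosedNeighbour a → ClosedNeighbour b → a ≢ b → Adj (G ⟨ v ⟩) a b
  closedNeighbours-adjacent (inj₁ refl) (inj₁ refl) a≢b = contradiction refl a≢b
  closedNeighbours-adjacent (inj₁ refl) (inj₂ v~b)  _   = inj₁ v~b
  closedNeighbours-adjacent (inj₂ v~a)  (inj₁ refl) _   = inj₁ (adj-sym G v~a)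
  closedNeighbours-adjacent (inj₂ v~a)  (inj₂ v~b)  a≢b = inj₂ (a≢b , v~a , v~b)

  ⟨⟩-clique∋v⇒closedNeighbour : ∀ {C x} → IsClique (G ⟨ v ⟩) C → v ∈ C → x ∈ C → ClosedNeighbour x
  ⟨⟩-clique∋v⇒closedNeighbour {x = x} C-clique v∈C x∈C with x ≟ᶠ v
  ... | yes x≡v = inj₁ x≡v
  ... | no x≢v with C-clique v x v∈C x∈C (x≢v ∘ sym)
  ...   | inj₁ v~x           = inj₂ v~x
  ...   | inj₂ (_ , v~v , _) = contradiction v~v (irrefl G)

  ⟨⟩-maximalClique∋v-unique : ∀ {C C′} → IsMaximalClique (G ⟨ v ⟩) C → IsMaximalClique (G ⟨ v ⟩) C′ →
    v ∈ C → v ∈ C′ → C ≡ C′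
  ⟨⟩-maximalClique∋v-unique {C} {C′} (C-clique , C-max) (C′-clique , C′-max) v∈C v∈C′ =
    ⊆-antisym (λ x∈C → C′-max (C ∪ C′) ∪-clique (q⊆p∪q C C′) (p⊆p∪q C′ x∈C))
              (λ x∈C′ → C-max (C ∪ C′) ∪-clique (p⊆p∪q C′) (q⊆p∪q C C′ x∈C′))
    where
    closed : ∀ {x} → x ∈ C ∪ C′ → ClosedNeighbour x
    closed x∈ = [ ⟨⟩-clique∋v⇒closedNeighbour C-clique v∈C , ⟨⟩-clique∋v⇒closedNeighbour C′-clique v∈C′ ]′
                  (x∈p∪q⁻ C C′ x∈)
    ∪-clique : IsClique (G ⟨ v ⟩) (C ∪ C′)
    ∪-clique a b a∈ b∈ = closedNeighbours-adjacent (closed a∈) (closed b∈)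

  -- After with v ∈? C, collapse K C reduces to K or to C.
  collapse : Subset n → Subset n → Subset n
  collapse K C = if does (v ∈? C) then K else C

  internal⇒otherMaximalClique : ∀ {b K} → NumMaxCliques G b → IsInternal G v → IsMaximalClique G K → v ∈ K →
    ∃[ K′ ] (IsMaximalClique G K′ × v ∈ K′ × K′ ≢ K)
  internal⇒otherMaximalClique {K = K} (L , _ , ∈L , _) internal K-maximal v∈K
    with anyᴸ? (λ D → v ∈? D ×-dec ¬? (≡-dec _≟ᵇ_ D K)) L
  ... | yes found with K′ , K′∈L , v∈K′ , K′≢K ← find found = K′ , Equivalence.to (∈L K′) K′∈L , v∈K′ , K′≢K
  ... | no none = contradiction (K , K-maximal , v∈K , unique) internal
    where
    unique : ∀ D → IsMaximalClique G D → v ∈ D → D ≡ K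
    unique D D-maximal v∈D =
      decidable-stable (≡-dec _≟ᵇ_ D K) λ D≢K → none (lose (Equivalence.from (∈L D) D-maximal) (v∈D , D≢K))

  module _ (Adj? : ∀ u w → Dec (Adj G u w)) (chordal : IsChordal G) where

    ⟨⟩-maximalClique∌v⇒clique : ∀ {C} → IsMaximalClique (G ⟨ v ⟩) C → v ∉ C → IsClique G C
    ⟨⟩-maximalClique∌v⇒clique {C} (C-clique , C-max) v∉C u w u∈C w∈C u≢w with C-clique u w u∈C w∈C u≢w
    ... | inj₁ u~w = u~w
    ... | inj₂ (_ , v~u , v~w) with any? (λ x → x ∈? C ×-dec ¬? (Adj? v x))
    ...   | no none = contradiction (C-max (C ∪ ⁅ v ⁆) ∪⁅v⁆-clique (p⊆p∪q ⁅ v ⁆) (q⊆p∪q C ⁅ v ⁆ (x∈⁅x⁆ v))) v∉C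
      where
      closed : ∀ {x} → x ∈ C ∪ ⁅ v ⁆ → ClosedNeighbour x
      closed {x} x∈ with x∈p∪q⁻ C ⁅ v ⁆ x∈
      ... | inj₁ x∈C = inj₂ (decidable-stable (Adj? v x) λ v≁x → none (x , x∈C , v≁x))
      ... | inj₂ x∈v = inj₁ (x∈⁅y⁆⇒x≡y v x∈v)
      ∪⁅v⁆-clique : IsClique (G ⟨ v ⟩) (C ∪ ⁅ v ⁆)
      ∪⁅v⁆-clique a b a∈ b∈ = closedNeighbours-adjacent (closed a∈) (closed b∈)
    ...   | yes (x , x∈C , v≁x) =
      [ ⊥-elim ∘ v≁x , id ]′
        (chordal-square-diagonal {G = G} chordal v~u (old-edge u∈C (λ { refl → v≁x v~u }))
          (adj-sym G (old-edge w∈C λ { refl → v≁x v~w })) (adj-sym G v~w) (λ { refl → v∉C x∈C }) u≢w)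
      where
      old-edge : ∀ {y} → y ∈ C → y ≢ x → Adj G y x
      old-edge {y} y∈C y≢x with C-clique y x y∈C x∈C y≢x
      ... | inj₁ y~x           = y~x
      ... | inj₂ (_ , _ , v~x) = contradiction v~x v≁x

    ⟨⟩-maximalClique∌v⇒maximalClique : ∀ {C} → IsMaximalClique (G ⟨ v ⟩) C → v ∉ C → IsMaximalClique G C
    ⟨⟩-maximalClique∌v⇒maximalClique C-maximal v∉C =
      ⟨⟩-maximalClique∌v⇒clique C-maximal v∉C ,
      λ D D-clique → proj₂ C-maximal D (λ a b a∈ b∈ a≢b → inj₁ (D-clique a b a∈ b∈ a≢b))

    ⟨⟩-fewerMaximalCliques : IsInternal G v → ∀ {a b} → NumMaxCliques (G ⟨ v ⟩) a → NumMaxCliques G b → a < b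
    ⟨⟩-fewerMaximalCliques internal count⟨⟩ count
      with K , K-maximal , ⁅v⁆⊆K ← maximalClique-⊇ {G = G} Adj? (⁅⁆-clique G v)
      with K′ , K′-maximal , v∈K′ , K′≢K ← internal⇒otherMaximalClique count internal K-maximal (⁅v⁆⊆K (x∈⁅x⁆ v))
      = HasCount-<-injection count⟨⟩ count (collapse K) maximal injective K′ K′-maximal missed
      where
      v∈K : v ∈ K
      v∈K = ⁅v⁆⊆K (x∈⁅x⁆ v)
      maximal : ∀ {C} → IsMaximalClique (G ⟨ v ⟩) C → IsMaximalClique G (collapse K C)
      maximal {C} C-maximal with v ∈? C
      ... | yes _   = K-maximal
      ... | no v∉C  = ⟨⟩-maximalClique∌v⇒maximalClique C-maximal v∉C
      injective : ∀ {C D} → IsMaximalClique (G ⟨ v ⟩) C → IsMaximalClique (G ⟨ v ⟩) D →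
        collapse K C ≡ collapse K D → C ≡ D
      injective {C} {D} C-maximal D-maximal eq with v ∈? C | v ∈? D
      ... | yes v∈C | yes v∈D = ⟨⟩-maximalClique∋v-unique C-maximal D-maximal v∈C v∈D
      ... | yes _   | no v∉D  = contradiction (subst (v ∈_) eq v∈K) v∉D
      ... | no v∉C  | yes _   = contradiction (subst (v ∈_) (sym eq) v∈K) v∉C
      ... | no _    | no _    = eq
      missed : ∀ {C} → IsMaximalClique (G ⟨ v ⟩) C → collapse K C ≢ K′
      missed {C} _ eq with v ∈? C
      ... | yes _   = K′≢K (sym eq)
      ... | no v∉C  = v∉C (subst (v ∈_) (sym eq) v∈K′)

¬¬-∀-Fin : ∀ {k} {P : Fin k → Set} → (∀ i → ¬ ¬ P i) → ¬ ¬ (∀ i → P i)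
¬¬-∀-Fin {zero}  _   ¬∀ = ¬∀ λ ()
¬¬-∀-Fin {suc k} ¬¬P ¬∀ = ¬¬P zero λ p₀ → ¬¬-∀-Fin (¬¬P ∘ suc) λ ps → ¬∀ λ { zero → p₀ ; (suc i) → ps i }

¬¬-Adj? : ∀ {n} (G : Graph n) → ¬ ¬ (∀ u w → Dec (Adj G u w))
¬¬-Adj? G = ¬¬-∀-Fin λ u → ¬¬-∀-Fin λ w → ¬¬-excluded-middle

corollary3p13 : ∀ {n} (G : Graph n) (v : Fin n) →
    IsChordal G → IsInternal G v →
    IsChordal (G ⟨ v ⟩) ×
    (∀ (a b : ℕ) → NumMaxCliques (G ⟨ v ⟩) a → NumMaxCliques G b → a < b)
corollary3p13 G v chordal internal =
  ⟨⟩-chordal {G = G} {v} chordal ,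
  λ a b count⟨⟩ count → decidable-stable (a <? b)
    (¬¬-map (λ Adj? → ⟨⟩-fewerMaximalCliques {G = G} {v} Adj? chordal internal count⟨⟩ count) (¬¬-Adj? G))
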